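{- Let $T:\mathcal C\to\mathcal A$ be a covariant functor satisfying (Ax0), (Ax2), (Ax3), (Ax2*), (Ax3*) and (Ax5). Then the full subcategories $\mathrm{Max}(\mathcal C)$ and $\mathrm{Min}(\mathcal C)$ of $\mathcal C$ are abelian categories, and the restrictions of $T$ to $\mathrm{Max}(\mathcal C)$ and to $\mathrm{Min}(\mathcal C)$ are exact functors.
   Context: For $A\in\mathcal A$, the fibre $\mathcal F_A$ is the category whose objects are pairs $(C,f)$ with $C\in\mathcal C$ and $f:T(C)\to A$ an isomorphism, a morphism $(C,f)\to(C',f')$ being a morphism $g:C\to C'$ of $\mathcal C$ with $f=f'\circ T(g)$. Axioms: (Ax0) for every $C\in\mathcal C$ and every isomorphism $f:T(C)\to A'$ in $\mathcal A$ there is an isomorphism $g:C\to C'$ in $\mathcal C$ with $T(g)=f$; (Ax2) $\mathcal C$ and $\mathcal A$ admit pushouts and $T$ preserves them; (Ax2*) $\mathcal C$ and $\mathcal A$ admit fibre products and $T$ preserves them; (Ax3) for every $A$, $\mathcal F_A$ is either empty or has a final object; (Ax3*) for every $A$, $\mathcal F_A$ is either empty or has an initial object; (Ax5) $\mathcal C$ is additive, $\mathcal A$ is abelian and $T$ is additive. $\mathrm{Max}(\mathcal C)$ (resp. $\mathrm{Min}(\mathcal C)$) is the full subcategory of $\mathcal C$ whose objects are those $C$ for which $(C,\mathrm{id}_{T(C)})$ is a final (resp. initial) object of $\mathcal F_{T(C)}$. -}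

module Defs where

open import Level using (Level; _⊔_) renaming (suc to lsuc)
open import Relation.Binary using (Rel; IsEquivalence)
open import Data.Product using (Σ; _×_; _,_; proj₁; proj₂)
open import Algebra.Structures using (IsAbelianGroup)
open import Relation.Binary.PropositionalEquality using (_≡_; subst)

record Category (o ℓ e : Level) : Set (lsuc (o ⊔ ℓ ⊔ e)) where
  infix  4 _≈_
  infixr 9 _∘_
  field
    Obj       : Set o
    _⇒_       : Obj → Obj → Set ℓ
    _≈_       : ∀ {A B} → Rel (A ⇒ B) e
    id        : ∀ {A} → A ⇒ A
    _∘_       : ∀ {A B C} → B ⇒ C → A ⇒ B → A ⇒ C
    equiv     : ∀ {A B} → IsEquivalence (_≈_ {A} {B})
    assoc     : ∀ {A B C D} {f : A ⇒ B} {g : B ⇒ C} {h : C ⇒ D} →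
                (h ∘ g) ∘ f ≈ h ∘ (g ∘ f)
    identityˡ : ∀ {A B} {f : A ⇒ B} → id ∘ f ≈ f
    identityʳ : ∀ {A B} {f : A ⇒ B} → f ∘ id ≈ f
    ∘-resp-≈  : ∀ {A B C} {f h : B ⇒ C} {g i : A ⇒ B} →
                f ≈ h → g ≈ i → f ∘ g ≈ h ∘ i

FullSub : ∀ {o ℓ e p} (𝒞 : Category o ℓ e) → (Category.Obj 𝒞 → Set p) →
          Category (o ⊔ p) ℓ e
FullSub 𝒞 P = record
  { Obj       = Σ Obj P
  ; _⇒_       = λ X Y → proj₁ X ⇒ proj₁ Y
  ; _≈_       = _≈_
  ; id        = id
  ; _∘_       = _∘_
  ; equiv     = equiv
  ; assoc     = assoc
  ; identityˡ = identityˡ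
  ; identityʳ = identityʳ
  ; ∘-resp-≈  = ∘-resp-≈
  }
  where open Category 𝒞

record Functor {o ℓ e o′ ℓ′ e′ : Level} (𝒞 : Category o ℓ e) (𝒟 : Category o′ ℓ′ e′)
       : Set (o ⊔ ℓ ⊔ e ⊔ o′ ⊔ ℓ′ ⊔ e′) where
  private
    module C = Category 𝒞
    module D = Category 𝒟
  field
    F₀           : C.Obj → D.Obj
    F₁           : ∀ {A B} → A C.⇒ B → F₀ A D.⇒ F₀ B
    identity     : ∀ {A} → F₁ (C.id {A}) D.≈ D.id
    homomorphism : ∀ {A B C} {f : A C.⇒ B} {g : B C.⇒ C} →
                   F₁ (g C.∘ f) D.≈ F₁ g D.∘ F₁ f
    F-resp-≈     : ∀ {A B} {f g : A C.⇒ B} → f C.≈ g → F₁ f D.≈ F₁ g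

restrict : ∀ {o ℓ e o′ ℓ′ e′ p} {𝒞 : Category o ℓ e} {𝒟 : Category o′ ℓ′ e′}
           (P : Category.Obj 𝒞 → Set p) → Functor 𝒞 𝒟 → Functor (FullSub 𝒞 P) 𝒟
restrict P F = record
  { F₀           = λ X → F₀ (proj₁ X)
  ; F₁           = F₁
  ; identity     = identity
  ; homomorphism = homomorphism
  ; F-resp-≈     = F-resp-≈
  }
  where open Functor F

module Notions {o ℓ e : Level} (𝒞 : Category o ℓ e) where
  open Category 𝒞

  ∃!⇒ : ∀ {p} {A B : Obj} → (A ⇒ B → Set p) → Set (ℓ ⊔ e ⊔ p)
  ∃!⇒ {A = A} {B} P = Σ (A ⇒ B) λ u → P u × (∀ v → P v → v ≈ u)

  IsIso : ∀ {A B} → A ⇒ B → Set (ℓ ⊔ e)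
  IsIso {A} {B} f = Σ (B ⇒ A) λ g → (g ∘ f ≈ id) × (f ∘ g ≈ id)

  IsInitial : Obj → Set (o ⊔ ℓ ⊔ e)
  IsInitial I = ∀ X → ∃!⇒ {A = I} {X} (λ _ → Lift′)
    where Lift′ = Level.Lift e Data.Unit.⊤ where import Data.Unit

  IsTerminal : Obj → Set (o ⊔ ℓ ⊔ e)
  IsTerminal T = ∀ X → ∃!⇒ {A = X} {T} (λ _ → Level.Lift e Data.Unit.⊤)
    where import Data.Unit

  IsPushout : ∀ {A B C P} (f : A ⇒ B) (g : A ⇒ C) (i₁ : B ⇒ P) (i₂ : C ⇒ P) →
              Set (o ⊔ ℓ ⊔ e)
  IsPushout {A} {B} {C} {P} f g i₁ i₂ =
    (i₁ ∘ f ≈ i₂ ∘ g) ×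
    (∀ {Q} (h₁ : B ⇒ Q) (h₂ : C ⇒ Q) → h₁ ∘ f ≈ h₂ ∘ g →
       ∃!⇒ {A = P} {Q} (λ u → (u ∘ i₁ ≈ h₁) × (u ∘ i₂ ≈ h₂)))

  HasPushouts : Set (o ⊔ ℓ ⊔ e)
  HasPushouts = ∀ {A B C} (f : A ⇒ B) (g : A ⇒ C) →
    Σ Obj λ P → Σ (B ⇒ P) λ i₁ → Σ (C ⇒ P) λ i₂ → IsPushout f g i₁ i₂

  IsPullback : ∀ {A B C P} (f : B ⇒ A) (g : C ⇒ A) (p₁ : P ⇒ B) (p₂ : P ⇒ C) →
               Set (o ⊔ ℓ ⊔ e)
  IsPullback {A} {B} {C} {P} f g p₁ p₂ =
    (f ∘ p₁ ≈ g ∘ p₂) ×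
    (∀ {Q} (h₁ : Q ⇒ B) (h₂ : Q ⇒ C) → f ∘ h₁ ≈ g ∘ h₂ →
       ∃!⇒ {A = Q} {P} (λ u → (p₁ ∘ u ≈ h₁) × (p₂ ∘ u ≈ h₂)))

  HasPullbacks : Set (o ⊔ ℓ ⊔ e)
  HasPullbacks = ∀ {A B C} (f : B ⇒ A) (g : C ⇒ A) →
    Σ Obj λ P → Σ (P ⇒ B) λ p₁ → Σ (P ⇒ C) λ p₂ → IsPullback f g p₁ p₂

  IsMono : ∀ {A B} → A ⇒ B → Set (o ⊔ ℓ ⊔ e)
  IsMono {A} {B} f = ∀ {X} (g h : X ⇒ A) → f ∘ g ≈ f ∘ h → g ≈ h

  IsEpi : ∀ {A B} → A ⇒ B → Set (o ⊔ ℓ ⊔ e)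
  IsEpi {A} {B} f = ∀ {X} (g h : B ⇒ X) → g ∘ f ≈ h ∘ f → g ≈ h

  record Preadditive : Set (o ⊔ ℓ ⊔ e) where
    infixl 6 _+_
    field
      _+_            : ∀ {A B} → A ⇒ B → A ⇒ B → A ⇒ B
      0H             : ∀ {A B} → A ⇒ B
      -_             : ∀ {A B} → A ⇒ B → A ⇒ B
      isAbelianGroup : ∀ {A B} → IsAbelianGroup (_≈_ {A} {B}) _+_ 0H -_
      ∘-distribˡ     : ∀ {A B C} {f : B ⇒ C} {g h : A ⇒ B} →
                       f ∘ (g + h) ≈ (f ∘ g) + (f ∘ h)
      ∘-distribʳ     : ∀ {A B C} {f : A ⇒ B} {g h : B ⇒ C} →
                       (g + h) ∘ f ≈ (g ∘ f) + (h ∘ f)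

  module WithPreadditive (PA : Preadditive) where
    open Preadditive PA

    IsBiproduct : ∀ {A B S} (p₁ : S ⇒ A) (p₂ : S ⇒ B) (i₁ : A ⇒ S) (i₂ : B ⇒ S) →
                  Set e
    IsBiproduct p₁ p₂ i₁ i₂ =
      (p₁ ∘ i₁ ≈ id) × (p₂ ∘ i₂ ≈ id) × (p₁ ∘ i₂ ≈ 0H) × (p₂ ∘ i₁ ≈ 0H) ×
      ((i₁ ∘ p₁) + (i₂ ∘ p₂) ≈ id)

    IsKernel : ∀ {K B C} (g : B ⇒ C) (k : K ⇒ B) → Set (o ⊔ ℓ ⊔ e)
    IsKernel {K} {B} {C} g k =
      (g ∘ k ≈ 0H) ×
      (∀ {X} (h : X ⇒ B) → g ∘ h ≈ 0H → ∃!⇒ {A = X} {K} (λ u → k ∘ u ≈ h))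

    IsCokernel : ∀ {A B Q} (f : A ⇒ B) (c : B ⇒ Q) → Set (o ⊔ ℓ ⊔ e)
    IsCokernel {A} {B} {Q} f c =
      (c ∘ f ≈ 0H) ×
      (∀ {X} (h : B ⇒ X) → h ∘ f ≈ 0H → ∃!⇒ {A = Q} {X} (λ u → u ∘ c ≈ h))

  record Additive : Set (o ⊔ ℓ ⊔ e) where
    field
      preadditive : Preadditive
    open WithPreadditive preadditive public
    field
      zero      : Obj
      zeroInit  : IsInitial zero
      zeroTerm  : IsTerminal zero
      biproduct : ∀ A B → Σ Obj λ S → Σ (S ⇒ A) λ p₁ → Σ (S ⇒ B) λ p₂ →
                  Σ (A ⇒ S) λ i₁ → Σ (B ⇒ S) λ i₂ → IsBiproduct p₁ p₂ i₁ i₂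

  record Abelian : Set (o ⊔ ℓ ⊔ e) where
    field
      additive : Additive
    open Additive additive public
    field
      kernel      : ∀ {B C} (g : B ⇒ C) → Σ Obj λ K → Σ (K ⇒ B) λ k → IsKernel g k
      cokernel    : ∀ {A B} (f : A ⇒ B) → Σ Obj λ Q → Σ (B ⇒ Q) λ c → IsCokernel f c
      monoNormal  : ∀ {A B} (f : A ⇒ B) → IsMono f →
                    Σ Obj λ C → Σ (B ⇒ C) λ g → IsKernel g f
      epiNormal   : ∀ {A B} (g : A ⇒ B) → IsEpi g →
                    Σ Obj λ K → Σ (K ⇒ A) λ f → IsCokernel f g

module FunctorNotions {o ℓ e o′ ℓ′ e′ : Level}
       {𝒞 : Category o ℓ e} {𝒟 : Category o′ ℓ′ e′} (F : Functor 𝒞 𝒟) where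
  private
    module C = Category 𝒞
    module D = Category 𝒟
    module NC = Notions 𝒞
    module ND = Notions 𝒟
  open Functor F

  PreservesPushouts : Set (o ⊔ ℓ ⊔ e ⊔ o′ ⊔ ℓ′ ⊔ e′)
  PreservesPushouts = ∀ {A B C P} (f : A C.⇒ B) (g : A C.⇒ C)
    (i₁ : B C.⇒ P) (i₂ : C C.⇒ P) → NC.IsPushout f g i₁ i₂ →
    ND.IsPushout (F₁ f) (F₁ g) (F₁ i₁) (F₁ i₂)

  PreservesPullbacks : Set (o ⊔ ℓ ⊔ e ⊔ o′ ⊔ ℓ′ ⊔ e′)
  PreservesPullbacks = ∀ {A B C P} (f : B C.⇒ A) (g : C C.⇒ A)
    (p₁ : P C.⇒ B) (p₂ : P C.⇒ C) → NC.IsPullback f g p₁ p₂ →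
    ND.IsPullback (F₁ f) (F₁ g) (F₁ p₁) (F₁ p₂)

  IsAdditiveFunctor : NC.Preadditive → ND.Preadditive → Set (o ⊔ ℓ ⊔ e′)
  IsAdditiveFunctor PC PD = ∀ {A B} (f g : A C.⇒ B) →
    F₁ (f PC.+ g) D.≈ (F₁ f PD.+ F₁ g)
    where module PC = NC.Preadditive PC
          module PD = ND.Preadditive PD

  IsExact : NC.Abelian → ND.Abelian → Set (o ⊔ ℓ ⊔ e ⊔ o′ ⊔ ℓ′ ⊔ e′)
  IsExact AC AD = ∀ {A B C} (f : A C.⇒ B) (g : B C.⇒ C) →
    AC.IsKernel g f → AC.IsCokernel f g →
    AD.IsKernel (F₁ g) (F₁ f) × AD.IsCokernel (F₁ f) (F₁ g)
    where module AC = NC.Abelian AC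
          module AD = ND.Abelian AD

module FibreNotions {o ℓ e o′ ℓ′ e′ : Level}
       {𝒞 : Category o ℓ e} {𝒜 : Category o′ ℓ′ e′} (T : Functor 𝒞 𝒜) where
  private
    module C = Category 𝒞
    module A = Category 𝒜
    module NA = Notions 𝒜
  open Functor T

  FibObj : A.Obj → Set (o ⊔ ℓ′ ⊔ e′)
  FibObj A = Σ C.Obj λ C → Σ (F₀ C A.⇒ A) NA.IsIso

  FibHom : ∀ {A} → FibObj A → FibObj A → Set (ℓ ⊔ e′)
  FibHom (C , f , _) (C′ , f′ , _) = Σ (C C.⇒ C′) λ g → f A.≈ f′ A.∘ F₁ g

  -- morphisms of 𝓕_A are equal when their underlying morphisms of 𝒞 are
  IsFinalFib : ∀ {A} → FibObj A → Set (o ⊔ ℓ ⊔ e ⊔ ℓ′ ⊔ e′)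
  IsFinalFib {A} X = ∀ (Y : FibObj A) →
    Σ (FibHom Y X) λ u → ∀ (v : FibHom Y X) → proj₁ v C.≈ proj₁ u

  IsInitialFib : ∀ {A} → FibObj A → Set (o ⊔ ℓ ⊔ e ⊔ ℓ′ ⊔ e′)
  IsInitialFib {A} X = ∀ (Y : FibObj A) →
    Σ (FibHom X Y) λ u → ∀ (v : FibHom X Y) → proj₁ v C.≈ proj₁ u

  idIso : ∀ {A} → NA.IsIso (A.id {A})
  idIso = A.id , A.identityˡ , A.identityˡ

  canon : (C : C.Obj) → FibObj (F₀ C)
  canon C = C , A.id , idIso

  IsMax : C.Obj → Set (o ⊔ ℓ ⊔ e ⊔ ℓ′ ⊔ e′)
  IsMax C = IsFinalFib (canon C)

  IsMin : C.Obj → Set (o ⊔ ℓ ⊔ e ⊔ ℓ′ ⊔ e′)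
  IsMin C = IsInitialFib (canon C)

  Max : Category (o ⊔ ℓ ⊔ e ⊔ ℓ′ ⊔ e′) ℓ e
  Max = FullSub 𝒞 IsMax

  Min : Category (o ⊔ ℓ ⊔ e ⊔ ℓ′ ⊔ e′) ℓ e
  Min = FullSub 𝒞 IsMin

  -- (Ax0) : T(g) = f ; this forces T(C′) = A′ (strict equality of objects),
  -- and T(g) is compared with f after transport along that equality.
  Ax0 : Set (o ⊔ ℓ ⊔ e ⊔ o′ ⊔ ℓ′ ⊔ e′)
  Ax0 = ∀ (C : C.Obj) {A′ : A.Obj} (f : F₀ C A.⇒ A′) → NA.IsIso f →
        Σ C.Obj λ C′ → Σ (F₀ C′ ≡ A′) λ p → Σ (C C.⇒ C′) λ g →
          Notions.IsIso 𝒞 g × (subst (λ X → F₀ C A.⇒ X) p (F₁ g) A.≈ f)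

  -- (Ax3) : 𝓕_A is empty or has a final object
  --         (read as: if 𝓕_A is inhabited then it has a final object)
  Ax3 : Set (o ⊔ ℓ ⊔ e ⊔ o′ ⊔ ℓ′ ⊔ e′)
  Ax3 = ∀ (A : A.Obj) → FibObj A → Σ (FibObj A) IsFinalFib

  Ax3* : Set (o ⊔ ℓ ⊔ e ⊔ o′ ⊔ ℓ′ ⊔ e′)
  Ax3* = ∀ (A : A.Obj) → FibObj A → Σ (FibObj A) IsInitialFib

module Submission where

-- Everything is proved for an abstract class P of objects of 𝒞 which is
-- "Min-like" for T: an isomorphism T M ≅ T Y with M in P is the image of a morphism
-- M → Y, an endomorphism of M in P with image the identity is the identity, and every
-- object is isomorphic under T to one in P.  Min(𝒞) is Min-like for T by (Ax3*), and
-- Max(𝒞) is Min-like for the opposite functor Tᵒᵖ : 𝒞ᵒᵖ → 𝒜ᵒᵖ by (Ax3).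
--   1. In a preadditive category, a pullback along a morphism out of a zero object is
--      a kernel, and kernels are unique up to isomorphism.  Hence, T preserving
--      pullbacks, every kernel in 𝒜 of T a with source T M, M in P, is T of a morphism
--      of 𝒞.  This gives faithfulness of T on P, and, applied to a "graph
--      automorphism" of a biproduct, fullness (module FullyFaithful).
--   2. A class on which T is fully faithful and which represents every object
--      inherits from 𝒜 a zero object, biproducts, kernels (computed by pullbacks) and
--      normality of monomorphisms, and T preserves kernels (modules
--      SubcategoryKernels, SubcategoryIsAbelian).
--   3. The dual facts (cokernels, normal epimorphisms) are the same statements for Tᵒᵖ.

open import Defs
open import Level using (Level; _⊔_; lift)
open import Data.Unit using (tt)
open import Data.Product using (Σ; _×_; _,_; proj₁; proj₂)
open import Relation.Binary.Bundles using (Setoid)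
open import Algebra.Structures using (IsAbelianGroup)
open import Algebra.Bundles using (Group)
import Algebra.Properties.Group as GroupProperties

module CategoryLemmas {o ℓ e} (𝒞 : Category o ℓ e) where
  open Category 𝒞
  open Notions 𝒞 using (IsIso)

  homSetoid : Obj → Obj → Setoid ℓ e
  homSetoid A B = record { Carrier = A ⇒ B ; _≈_ = _≈_ ; isEquivalence = equiv }

  module _ {A B : Obj} where
    open Setoid (homSetoid A B) public
      using () renaming (refl to ≈-refl; sym to ≈-sym; trans to ≈-trans)
    open import Relation.Binary.Reasoning.Setoid (homSetoid A B) public

  infixr 4 _⟩∘⟨_ refl⟩∘⟨_
  infixl 5 _⟩∘⟨refl

  _⟩∘⟨_ : ∀ {A B C} {f h : B ⇒ C} {g i : A ⇒ B} → f ≈ h → g ≈ i → f ∘ g ≈ h ∘ i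
  _⟩∘⟨_ = ∘-resp-≈

  refl⟩∘⟨_ : ∀ {A B C} {f : B ⇒ C} {g i : A ⇒ B} → g ≈ i → f ∘ g ≈ f ∘ i
  refl⟩∘⟨ p = ∘-resp-≈ ≈-refl p

  _⟩∘⟨refl : ∀ {A B C} {f h : B ⇒ C} {g : A ⇒ B} → f ≈ h → f ∘ g ≈ h ∘ g
  p ⟩∘⟨refl = ∘-resp-≈ p ≈-refl

  assoc˘ : ∀ {A B C D} {f : A ⇒ B} {g : B ⇒ C} {h : C ⇒ D} → h ∘ (g ∘ f) ≈ (h ∘ g) ∘ f
  assoc˘ = ≈-sym assoc

  inv : ∀ {A B} {f : A ⇒ B} → IsIso f → B ⇒ A
  inv = proj₁

  invˡ : ∀ {A B} {f : A ⇒ B} (i : IsIso f) → inv i ∘ f ≈ id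
  invˡ i = proj₁ (proj₂ i)

  invʳ : ∀ {A B} {f : A ⇒ B} (i : IsIso f) → f ∘ inv i ≈ id
  invʳ i = proj₂ (proj₂ i)

  inv-iso : ∀ {A B} {f : A ⇒ B} (i : IsIso f) → IsIso (inv i)
  inv-iso {f = f} i = f , invʳ i , invˡ i

  cancel-inverse : ∀ {A B C D} {n : B ⇒ C} (i : IsIso n) {h : B ⇒ D} {g : A ⇒ B} →
                   (h ∘ inv i) ∘ (n ∘ g) ≈ h ∘ g
  cancel-inverse {n = n} i {h} {g} = begin
    (h ∘ inv i) ∘ (n ∘ g)  ≈⟨ assoc ⟩
    h ∘ (inv i ∘ (n ∘ g))  ≈⟨ refl⟩∘⟨ assoc˘ ⟩
    h ∘ ((inv i ∘ n) ∘ g)  ≈⟨ refl⟩∘⟨ invˡ i ⟩∘⟨refl ⟩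
    h ∘ (id ∘ g)           ≈⟨ refl⟩∘⟨ identityˡ ⟩
    h ∘ g                  ∎

  ∘-iso : ∀ {A B C} {f : A ⇒ B} {g : B ⇒ C} → IsIso f → IsIso g → IsIso (g ∘ f)
  ∘-iso {f = f} {g} i j = inv i ∘ inv j
    , ≈-trans (cancel-inverse j) (invˡ i)
    , ≈-trans (cancel-inverse (inv-iso i)) (invʳ j)

  iso-cancelˡ : ∀ {A B C} {n : B ⇒ C} (i : IsIso n) {f g : A ⇒ B} → n ∘ f ≈ n ∘ g → f ≈ g
  iso-cancelˡ {n = n} i {f} {g} p = begin
    f                       ≈⟨ identityˡ ⟨
    id ∘ f                  ≈⟨ cancel-inverse i ⟨
    (id ∘ inv i) ∘ (n ∘ f)  ≈⟨ refl⟩∘⟨ p ⟩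
    (id ∘ inv i) ∘ (n ∘ g)  ≈⟨ cancel-inverse i ⟩
    id ∘ g                  ≈⟨ identityˡ ⟩
    g                       ∎

module FunctorLemmas {o ℓ e o′ ℓ′ e′} {𝒞 : Category o ℓ e} {𝒜 : Category o′ ℓ′ e′}
       (F : Functor 𝒞 𝒜) where
  private
    module C = Category 𝒞
  open Category 𝒜
  open CategoryLemmas 𝒜
  open Functor F

  F-triangle : ∀ {A B C} {f : A C.⇒ B} {g : B C.⇒ C} {h : A C.⇒ C} →
               g C.∘ f C.≈ h → F₁ g ∘ F₁ f ≈ F₁ h
  F-triangle p = ≈-trans (≈-sym homomorphism) (F-resp-≈ p)

  F-iso : ∀ {A B} {f : A C.⇒ B} → Notions.IsIso 𝒞 f → Notions.IsIso 𝒜 (F₁ f)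
  F-iso (g , gf , fg) = F₁ g
    , ≈-trans (F-triangle gf) identity
    , ≈-trans (F-triangle fg) identity

Op : ∀ {o ℓ e} → Category o ℓ e → Category o ℓ e
Op 𝒞 = record
  { Obj = Obj ; _⇒_ = λ A B → B ⇒ A ; _≈_ = _≈_ ; id = id ; _∘_ = λ f g → g ∘ f
  ; equiv = equiv ; assoc = assoc˘ ; identityˡ = identityʳ ; identityʳ = identityˡ
  ; ∘-resp-≈ = λ p q → ∘-resp-≈ q p }
  where open Category 𝒞
        open CategoryLemmas 𝒞 using (assoc˘)

OpF : ∀ {o ℓ e o′ ℓ′ e′} {𝒞 : Category o ℓ e} {𝒜 : Category o′ ℓ′ e′} →
      Functor 𝒞 𝒜 → Functor (Op 𝒞) (Op 𝒜)
OpF T = record { F₀ = F₀ ; F₁ = F₁ ; identity = identity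
               ; homomorphism = homomorphism ; F-resp-≈ = F-resp-≈ }
  where open Functor T

OpPA : ∀ {o ℓ e} {𝒞 : Category o ℓ e} → Notions.Preadditive 𝒞 → Notions.Preadditive (Op 𝒞)
OpPA PA = record { _+_ = _+_ ; 0H = 0H ; -_ = -_ ; isAbelianGroup = isAbelianGroup
                 ; ∘-distribˡ = ∘-distribʳ ; ∘-distribʳ = ∘-distribˡ }
  where open Notions.Preadditive PA

op-iso : ∀ {o ℓ e} {𝒜 : Category o ℓ e} {A B} {f : Category._⇒_ 𝒜 A B} →
         Notions.IsIso 𝒜 f → Notions.IsIso (Op 𝒜) f
op-iso (g , gf , fg) = g , fg , gf

module PreadditiveLemmas {o ℓ e} (𝒞 : Category o ℓ e) (PA : Notions.Preadditive 𝒞) where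
  open Category 𝒞
  open Notions 𝒞
  open Preadditive PA
  open WithPreadditive PA
  open CategoryLemmas 𝒞

  homGroup : Obj → Obj → Group ℓ e
  homGroup A B = record
    { Carrier = A ⇒ B ; _≈_ = _≈_ ; _∙_ = _+_ ; ε = 0H ; _⁻¹ = -_
    ; isGroup = IsAbelianGroup.isGroup isAbelianGroup }

  module HomGroup {A B : Obj} = GroupProperties (homGroup A B)
  module +-AbGroup {A B : Obj} = IsAbelianGroup (isAbelianGroup {A} {B})

  +-cong : ∀ {A B} {x y u v : A ⇒ B} → x ≈ y → u ≈ v → x + u ≈ y + v
  +-cong = +-AbGroup.∙-cong

  x+x≈x⇒x≈0 : ∀ {A B} {x : A ⇒ B} → x + x ≈ x → x ≈ 0H
  x+x≈x⇒x≈0 {x = x} p = HomGroup.identityʳ-unique x x p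

  ∘-zeroˡ : ∀ {A B C} {f : A ⇒ B} → 0H {B} {C} ∘ f ≈ 0H
  ∘-zeroˡ {f = f} = x+x≈x⇒x≈0 (begin
    (0H ∘ f) + (0H ∘ f)  ≈⟨ ∘-distribʳ ⟨
    (0H + 0H) ∘ f        ≈⟨ +-AbGroup.identityˡ 0H ⟩∘⟨refl ⟩
    0H ∘ f               ∎)

  ∘-zeroʳ : ∀ {A B C} {f : B ⇒ C} → f ∘ 0H {A} {B} ≈ 0H
  ∘-zeroʳ {f = f} = x+x≈x⇒x≈0 (begin
    (f ∘ 0H) + (f ∘ 0H)  ≈⟨ ∘-distribˡ ⟨
    f ∘ (0H + 0H)        ≈⟨ refl⟩∘⟨ +-AbGroup.identityˡ 0H ⟩
    f ∘ 0H               ∎)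

  ∘-negʳ : ∀ {A B C} {f : B ⇒ C} {g : A ⇒ B} → f ∘ (- g) ≈ - (f ∘ g)
  ∘-negʳ {f = f} {g} = HomGroup.inverseʳ-unique (f ∘ g) (f ∘ (- g)) (begin
    (f ∘ g) + (f ∘ (- g))  ≈⟨ ∘-distribˡ ⟨
    f ∘ (g + (- g))        ≈⟨ refl⟩∘⟨ +-AbGroup.inverseʳ g ⟩
    f ∘ 0H                 ≈⟨ ∘-zeroʳ ⟩
    0H                     ∎)

  ∘-negˡ : ∀ {A B C} {f : B ⇒ C} {g : A ⇒ B} → (- f) ∘ g ≈ - (f ∘ g)
  ∘-negˡ {f = f} {g} = HomGroup.inverseʳ-unique (f ∘ g) ((- f) ∘ g) (begin
    (f ∘ g) + ((- f) ∘ g)  ≈⟨ ∘-distribʳ ⟨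
    (f + (- f)) ∘ g        ≈⟨ +-AbGroup.inverseʳ f ⟩∘⟨refl ⟩
    0H ∘ g                 ≈⟨ ∘-zeroˡ ⟩
    0H                     ∎)

  ∘-difference : ∀ {A B C} {f : B ⇒ C} {a b : A ⇒ B} → f ∘ a ≈ f ∘ b → f ∘ (a + (- b)) ≈ 0H
  ∘-difference {f = f} {a} {b} p = begin
    f ∘ (a + (- b))          ≈⟨ ∘-distribˡ ⟩
    (f ∘ a) + (f ∘ (- b))    ≈⟨ +-cong p ∘-negʳ ⟩
    (f ∘ b) + (- (f ∘ b))    ≈⟨ +-AbGroup.inverseʳ (f ∘ b) ⟩
    0H                       ∎

  id+c∘id+b≈id : ∀ {A} {b c : A ⇒ A} → c ∘ b ≈ 0H → c + b ≈ 0H → (id + c) ∘ (id + b) ≈ id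
  id+c∘id+b≈id {b = b} {c} cb c+b = begin
    (id + c) ∘ (id + b)                 ≈⟨ ∘-distribˡ ⟩
    ((id + c) ∘ id) + ((id + c) ∘ b)    ≈⟨ +-cong identityʳ ∘-distribʳ ⟩
    (id + c) + ((id ∘ b) + (c ∘ b))     ≈⟨ +-cong ≈-refl (+-cong identityˡ cb) ⟩
    (id + c) + (b + 0H)                 ≈⟨ +-cong ≈-refl (+-AbGroup.identityʳ b) ⟩
    (id + c) + b                        ≈⟨ +-AbGroup.assoc id c b ⟩
    id + (c + b)                        ≈⟨ +-cong ≈-refl c+b ⟩
    id + 0H                             ≈⟨ +-AbGroup.identityʳ id ⟩
    id                                  ∎

  id+nilpotent-iso : ∀ {A} (a : A ⇒ A) → a ∘ a ≈ 0H → IsIso (id + a)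
  id+nilpotent-iso a aa = id + (- a)
    , id+c∘id+b≈id (≈-trans ∘-negˡ -aa≈0) (+-AbGroup.inverseˡ a)
    , id+c∘id+b≈id (≈-trans ∘-negʳ -aa≈0) (+-AbGroup.inverseʳ a)
    where
      -aa≈0 : - (a ∘ a) ≈ 0H
      -aa≈0 = ≈-trans (+-AbGroup.⁻¹-cong aa) HomGroup.ε⁻¹≈ε

  IsZeroObject : Obj → Set (o ⊔ ℓ ⊔ e)
  IsZeroObject Z₀ = (∀ {X} (f : X ⇒ Z₀) → f ≈ 0H) × (∀ {X} (f : Z₀ ⇒ X) → f ≈ 0H)

  id≈0⇒zero-object : ∀ {Z₀} → id {Z₀} ≈ 0H → IsZeroObject Z₀
  id≈0⇒zero-object id≈0 =
      (λ f → ≈-trans (≈-sym identityˡ) (≈-trans (id≈0 ⟩∘⟨refl) ∘-zeroˡ))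
    , (λ f → ≈-trans (≈-sym identityʳ) (≈-trans (refl⟩∘⟨ id≈0) ∘-zeroʳ))

  initial⇒zero-object : ∀ {Z₀} → IsInitial Z₀ → IsZeroObject Z₀
  initial⇒zero-object {Z₀} init = id≈0⇒zero-object
    (≈-trans (unique id) (≈-sym (unique 0H)))
    where
      unique : (f : Z₀ ⇒ Z₀) → f ≈ proj₁ (init Z₀)
      unique f = proj₂ (proj₂ (init Z₀)) f (lift tt)

  iso-zero-object : ∀ {N Z₀} {n : N ⇒ Z₀} → IsIso n → IsZeroObject Z₀ → IsZeroObject N
  iso-zero-object {n = n} i (into , _) = id≈0⇒zero-object (begin
    id            ≈⟨ invˡ i ⟨
    inv i ∘ n     ≈⟨ refl⟩∘⟨ into n ⟩
    inv i ∘ 0H    ≈⟨ ∘-zeroʳ ⟩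
    0H            ∎)

  factor : ∀ {K B C X} {g : B ⇒ C} {k : K ⇒ B} → IsKernel g k →
           (h : X ⇒ B) → g ∘ h ≈ 0H → Σ (X ⇒ K) λ u → k ∘ u ≈ h
  factor (_ , universal) h gh≈0 = proj₁ (universal h gh≈0) , proj₁ (proj₂ (universal h gh≈0))

  kernel-resp-≈ : ∀ {K B C} {g g′ : B ⇒ C} {k : K ⇒ B} → g ≈ g′ → IsKernel g k → IsKernel g′ k
  kernel-resp-≈ g≈g′ (gk≈0 , universal) =
      ≈-trans (≈-sym g≈g′ ⟩∘⟨refl) gk≈0
    , λ h g′h≈0 → universal h (≈-trans (g≈g′ ⟩∘⟨refl) g′h≈0)

  killed-∘ : ∀ {X K B C} {g : B ⇒ C} {k : K ⇒ B} {h : X ⇒ K} → g ∘ k ≈ 0H → g ∘ (k ∘ h) ≈ 0H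
  killed-∘ gk≈0 = ≈-trans assoc˘ (≈-trans (gk≈0 ⟩∘⟨refl) ∘-zeroˡ)

  kernel⇒mono : ∀ {K B C} {g : B ⇒ C} {k : K ⇒ B} → IsKernel g k → IsMono k
  kernel⇒mono {k = k} (gk≈0 , universal) x y kx≈ky =
    let (_ , _ , unique) = universal (k ∘ y) (killed-∘ gk≈0)
    in  ≈-trans (unique x kx≈ky) (≈-sym (unique y ≈-refl))

  kernels-iso : ∀ {K K′ B C} {g : B ⇒ C} {k : K ⇒ B} {k′ : K′ ⇒ B} →
                IsKernel g k → IsKernel g k′ → Σ (K′ ⇒ K) λ u → k ∘ u ≈ k′ × IsIso u
  kernels-iso {k = k} {k′} ker ker′ =
    let (u , ku≈k′) = factor ker k′ (proj₁ ker′)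
        (v , k′v≈k) = factor ker′ k (proj₁ ker)
    in  u , ku≈k′ , v
      , kernel⇒mono ker′ (v ∘ u) id
          (≈-trans assoc˘ (≈-trans (k′v≈k ⟩∘⟨refl) (≈-trans ku≈k′ (≈-sym identityʳ))))
      , kernel⇒mono ker (u ∘ v) id
          (≈-trans assoc˘ (≈-trans (ku≈k′ ⟩∘⟨refl) (≈-trans k′v≈k (≈-sym identityʳ))))

  kernel-∘-iso : ∀ {K K′ B C} {g : B ⇒ C} {k : K ⇒ B} {n : K′ ⇒ K} {k′ : K′ ⇒ B} →
                 IsKernel g k → IsIso n → k ∘ n ≈ k′ → IsKernel g k′
  kernel-∘-iso {k = k} {n} {k′} ker i kn≈k′ =
      ≈-trans (refl⟩∘⟨ ≈-sym kn≈k′) (killed-∘ (proj₁ ker))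
    , λ h gh≈0 →
      let (u , ku≈h) = factor ker h gh≈0 in
        inv i ∘ u
      , (begin
          k′ ∘ (inv i ∘ u)       ≈⟨ kn≈k′ ⟩∘⟨refl ⟨
          (k ∘ n) ∘ (inv i ∘ u)  ≈⟨ cancel-inverse (inv-iso i) ⟩
          k ∘ u                  ≈⟨ ku≈h ⟩
          h                      ∎)
      , λ v k′v≈h → iso-cancelˡ i (kernel⇒mono ker (n ∘ v) (n ∘ (inv i ∘ u)) (begin
          k ∘ (n ∘ v)            ≈⟨ assoc˘ ⟩
          (k ∘ n) ∘ v            ≈⟨ kn≈k′ ⟩∘⟨refl ⟩
          k′ ∘ v                 ≈⟨ k′v≈h ⟩
          h                      ≈⟨ ku≈h ⟨
          k ∘ u                  ≈⟨ refl⟩∘⟨ identityˡ ⟨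
          k ∘ (id ∘ u)           ≈⟨ refl⟩∘⟨ invʳ i ⟩∘⟨refl ⟨
          k ∘ ((n ∘ inv i) ∘ u)  ≈⟨ refl⟩∘⟨ assoc ⟩
          k ∘ (n ∘ (inv i ∘ u))  ∎))

  kernel-precompose-iso : ∀ {K B B′ C} {g : B ⇒ C} {k : K ⇒ B} {m : B′ ⇒ B} →
                          IsKernel g k → (i : IsIso m) → IsKernel (g ∘ m) (inv i ∘ k)
  kernel-precompose-iso {k = k} {m} ker i =
      ≈-trans (cancel-inverse (inv-iso i)) (proj₁ ker)
    , λ h gmh≈0 →
      let (u , ku≈mh) = factor ker (m ∘ h) (≈-trans assoc˘ gmh≈0) in
        u
      , (begin
          (inv i ∘ k) ∘ u   ≈⟨ assoc ⟩
          inv i ∘ (k ∘ u)   ≈⟨ refl⟩∘⟨ ku≈mh ⟩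
          inv i ∘ (m ∘ h)   ≈⟨ assoc˘ ⟩
          (inv i ∘ m) ∘ h   ≈⟨ invˡ i ⟩∘⟨refl ⟩
          id ∘ h            ≈⟨ identityˡ ⟩
          h                 ∎)
      , λ v m⁻¹kv≈h → kernel⇒mono ker v u (begin
          k ∘ v                    ≈⟨ identityˡ ⟨
          id ∘ (k ∘ v)             ≈⟨ invʳ i ⟩∘⟨refl ⟨
          (m ∘ inv i) ∘ (k ∘ v)    ≈⟨ assoc ⟩
          m ∘ (inv i ∘ (k ∘ v))    ≈⟨ refl⟩∘⟨ assoc˘ ⟩
          m ∘ ((inv i ∘ k) ∘ v)    ≈⟨ refl⟩∘⟨ m⁻¹kv≈h ⟩
          m ∘ h                    ≈⟨ ku≈mh ⟨
          k ∘ u                    ∎)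

  id-kernel : ∀ {B C} {g : B ⇒ C} → g ≈ 0H → IsKernel g id
  id-kernel g≈0 =
      ≈-trans identityʳ g≈0
    , λ h _ → h , identityˡ , λ v id∘v≈h → ≈-trans (≈-sym identityˡ) id∘v≈h

  pullback-along-zero : ∀ {Z₀ K B C} {g : B ⇒ C} {z : Z₀ ⇒ C} {k : K ⇒ B} {t : K ⇒ Z₀} →
                        IsZeroObject Z₀ → IsPullback g z k t → IsKernel g k
  pullback-along-zero {g = g} {z} {k} {t} (into , _) (square , universal) =
      (begin
        g ∘ k    ≈⟨ square ⟩
        z ∘ t    ≈⟨ refl⟩∘⟨ into t ⟩
        z ∘ 0H   ≈⟨ ∘-zeroʳ ⟩
        0H       ∎)
    , λ h gh≈0 →
      let (u , (ku≈h , _) , unique) = universal h 0H (≈-trans gh≈0 (≈-sym ∘-zeroʳ)) in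
      u , ku≈h , λ v kv≈h → unique v (kv≈h , ≈-trans (into _) (≈-sym (into _)))

  zero-kernel⇒mono : ∀ {K B C} {g : B ⇒ C} {k : K ⇒ B} → IsKernel g k → k ≈ 0H → IsMono g
  zero-kernel⇒mono {k = k} ker k≈0 a b ga≈gb = HomGroup.x∙y⁻¹≈ε⇒x≈y a b (begin
    a + (- b)   ≈⟨ proj₂ (factor ker _ (∘-difference ga≈gb)) ⟨
    k ∘ _       ≈⟨ k≈0 ⟩∘⟨refl ⟩
    0H ∘ _      ≈⟨ ∘-zeroˡ ⟩
    0H          ∎)

  kernel-of-cokernel : ∀ {A B C Q} {g : B ⇒ C} {m : A ⇒ B} {c : B ⇒ Q} →
                       IsKernel g m → IsCokernel m c → IsKernel c m
  kernel-of-cokernel {g = g} {c = c} (gm≈0 , universal) (cm≈0 , cok-universal) =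
      cm≈0
    , λ h ch≈0 →
      let (w , wc≈g , _) = cok-universal g gm≈0 in
      universal h (begin
        g ∘ h          ≈⟨ wc≈g ⟩∘⟨refl ⟨
        (w ∘ c) ∘ h    ≈⟨ assoc ⟩
        w ∘ (c ∘ h)    ≈⟨ refl⟩∘⟨ ch≈0 ⟩
        w ∘ 0H         ≈⟨ ∘-zeroʳ ⟩
        0H             ∎)

  biproduct-kernel : ∀ {A B S} {p₁ : S ⇒ A} {p₂ : S ⇒ B} {i₁ : A ⇒ S} {i₂ : B ⇒ S} →
                     IsBiproduct p₁ p₂ i₁ i₂ → IsKernel p₂ i₁
  biproduct-kernel {p₁ = p₁} {p₂} {i₁} {i₂} (p₁i₁≈id , _ , _ , p₂i₁≈0 , sum≈id) =
      p₂i₁≈0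
    , λ h p₂h≈0 →
        p₁ ∘ h
      , ≈-sym (begin
          h                                    ≈⟨ identityˡ ⟨
          id ∘ h                               ≈⟨ sum≈id ⟩∘⟨refl ⟨
          ((i₁ ∘ p₁) + (i₂ ∘ p₂)) ∘ h          ≈⟨ ∘-distribʳ ⟩
          ((i₁ ∘ p₁) ∘ h) + ((i₂ ∘ p₂) ∘ h)    ≈⟨ +-cong assoc assoc ⟩
          (i₁ ∘ (p₁ ∘ h)) + (i₂ ∘ (p₂ ∘ h))    ≈⟨ +-cong ≈-refl (≈-trans (refl⟩∘⟨ p₂h≈0) ∘-zeroʳ) ⟩
          (i₁ ∘ (p₁ ∘ h)) + 0H                 ≈⟨ +-AbGroup.identityʳ _ ⟩
          i₁ ∘ (p₁ ∘ h)                        ∎)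
      , λ v i₁v≈h → begin
          v                 ≈⟨ identityˡ ⟨
          id ∘ v            ≈⟨ p₁i₁≈id ⟩∘⟨refl ⟨
          (p₁ ∘ i₁) ∘ v     ≈⟨ assoc ⟩
          p₁ ∘ (i₁ ∘ v)     ≈⟨ refl⟩∘⟨ i₁v≈h ⟩
          p₁ ∘ h            ∎

  graph-automorphism : ∀ {A B S} {p₁ : S ⇒ A} {p₂ : S ⇒ B} {i₁ : A ⇒ S} {i₂ : B ⇒ S} →
    IsBiproduct p₁ p₂ i₁ i₂ → (φ : A ⇒ B) →
    IsIso (id + i₂ ∘ (φ ∘ p₁)) × p₂ ∘ ((id + i₂ ∘ (φ ∘ p₁)) ∘ i₁) ≈ φ
  graph-automorphism {S = S} {p₁ = p₁} {p₂} {i₁} {i₂} (p₁i₁≈id , p₂i₂≈id , p₁i₂≈0 , p₂i₁≈0 , _) φ =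
    id+nilpotent-iso a a∘a≈0 , recovers-φ
    where
      a : S ⇒ S
      a = i₂ ∘ (φ ∘ p₁)
      a∘a≈0 : a ∘ a ≈ 0H
      a∘a≈0 = begin
        (i₂ ∘ (φ ∘ p₁)) ∘ (i₂ ∘ (φ ∘ p₁))    ≈⟨ assoc ⟩
        i₂ ∘ ((φ ∘ p₁) ∘ (i₂ ∘ (φ ∘ p₁)))    ≈⟨ refl⟩∘⟨ assoc ⟩
        i₂ ∘ (φ ∘ (p₁ ∘ (i₂ ∘ (φ ∘ p₁))))    ≈⟨ refl⟩∘⟨ refl⟩∘⟨ killed-∘ p₁i₂≈0 ⟩
        i₂ ∘ (φ ∘ 0H)                        ≈⟨ refl⟩∘⟨ ∘-zeroʳ ⟩
        i₂ ∘ 0H                              ≈⟨ ∘-zeroʳ ⟩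
        0H                                   ∎
      recovers-φ : p₂ ∘ ((id + a) ∘ i₁) ≈ φ
      recovers-φ = begin
        p₂ ∘ ((id + a) ∘ i₁)                 ≈⟨ refl⟩∘⟨ ∘-distribʳ ⟩
        p₂ ∘ ((id ∘ i₁) + (a ∘ i₁))          ≈⟨ ∘-distribˡ ⟩
        (p₂ ∘ (id ∘ i₁)) + (p₂ ∘ (a ∘ i₁))   ≈⟨ +-cong (≈-trans (refl⟩∘⟨ identityˡ) p₂i₁≈0) ≈-refl ⟩
        0H + (p₂ ∘ (a ∘ i₁))                 ≈⟨ +-AbGroup.identityˡ _ ⟩
        p₂ ∘ ((i₂ ∘ (φ ∘ p₁)) ∘ i₁)          ≈⟨ refl⟩∘⟨ assoc ⟩
        p₂ ∘ (i₂ ∘ ((φ ∘ p₁) ∘ i₁))          ≈⟨ assoc˘ ⟩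
        (p₂ ∘ i₂) ∘ ((φ ∘ p₁) ∘ i₁)          ≈⟨ p₂i₂≈id ⟩∘⟨ assoc ⟩
        id ∘ (φ ∘ (p₁ ∘ i₁))                 ≈⟨ identityˡ ⟩
        φ ∘ (p₁ ∘ i₁)                        ≈⟨ refl⟩∘⟨ p₁i₁≈id ⟩
        φ ∘ id                               ≈⟨ identityʳ ⟩
        φ                                    ∎

  transport-biproduct : ∀ {A B S S′} {p₁ : S ⇒ A} {p₂ : S ⇒ B} {i₁ : A ⇒ S} {i₂ : B ⇒ S}
    {n : S′ ⇒ S} (i : IsIso n) → IsBiproduct p₁ p₂ i₁ i₂ →
    IsBiproduct (p₁ ∘ n) (p₂ ∘ n) (inv i ∘ i₁) (inv i ∘ i₂)
  transport-biproduct {p₁ = p₁} {p₂} {i₁} {i₂} {n} i (e₁₁ , e₂₂ , e₁₂ , e₂₁ , sum≈id) =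
      ≈-trans (cancel-inverse (inv-iso i)) e₁₁
    , ≈-trans (cancel-inverse (inv-iso i)) e₂₂
    , ≈-trans (cancel-inverse (inv-iso i)) e₁₂
    , ≈-trans (cancel-inverse (inv-iso i)) e₂₁
    , (begin
        ((inv i ∘ i₁) ∘ (p₁ ∘ n)) + ((inv i ∘ i₂) ∘ (p₂ ∘ n))  ≈⟨ +-cong sandwich sandwich ⟩
        (inv i ∘ ((i₁ ∘ p₁) ∘ n)) + (inv i ∘ ((i₂ ∘ p₂) ∘ n))  ≈⟨ ∘-distribˡ ⟨
        inv i ∘ (((i₁ ∘ p₁) ∘ n) + ((i₂ ∘ p₂) ∘ n))            ≈⟨ refl⟩∘⟨ ∘-distribʳ ⟨
        inv i ∘ (((i₁ ∘ p₁) + (i₂ ∘ p₂)) ∘ n)                  ≈⟨ refl⟩∘⟨ sum≈id ⟩∘⟨refl ⟩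
        inv i ∘ (id ∘ n)                                       ≈⟨ refl⟩∘⟨ identityˡ ⟩
        inv i ∘ n                                              ≈⟨ invˡ i ⟩
        id                                                     ∎)
    where
      sandwich : ∀ {X Y U V W} {m : V ⇒ W} {x : U ⇒ V} {y : Y ⇒ U} {z : X ⇒ Y} →
                 (m ∘ x) ∘ (y ∘ z) ≈ m ∘ ((x ∘ y) ∘ z)
      sandwich = ≈-trans assoc (refl⟩∘⟨ assoc˘)

module AdditiveFunctorLemmas {o ℓ e o′ ℓ′ e′} {𝒞 : Category o ℓ e} {𝒜 : Category o′ ℓ′ e′}
  (T : Functor 𝒞 𝒜) (PC : Notions.Preadditive 𝒞) (PA : Notions.Preadditive 𝒜)
  (additive : FunctorNotions.IsAdditiveFunctor T PC PA) where
  private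
    module C = Category 𝒞
    module PC = Notions.Preadditive PC
    module LC = PreadditiveLemmas 𝒞 PC
  open Category 𝒜
  open Notions 𝒜
  open Preadditive PA
  open WithPreadditive PA
  open CategoryLemmas 𝒜
  open PreadditiveLemmas 𝒜 PA
  open FunctorLemmas T
  open Functor T

  F-zero : ∀ {A B} → F₁ (PC.0H {A} {B}) ≈ 0H
  F-zero = x+x≈x⇒x≈0 (begin
    F₁ PC.0H + F₁ PC.0H       ≈⟨ additive PC.0H PC.0H ⟨
    F₁ (PC.0H PC.+ PC.0H)     ≈⟨ F-resp-≈ (LC.+-AbGroup.identityˡ PC.0H) ⟩
    F₁ PC.0H                  ∎)

  F-neg : ∀ {A B} {f : A C.⇒ B} → F₁ (PC.- f) ≈ - F₁ f
  F-neg {f = f} = HomGroup.inverseʳ-unique (F₁ f) (F₁ (PC.- f)) (begin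
    F₁ f + F₁ (PC.- f)        ≈⟨ additive f (PC.- f) ⟨
    F₁ (f PC.+ (PC.- f))      ≈⟨ F-resp-≈ (LC.+-AbGroup.inverseʳ f) ⟩
    F₁ PC.0H                  ≈⟨ F-zero ⟩
    0H                        ∎)

  F-killed : ∀ {A B C} {f : A C.⇒ B} {g : B C.⇒ C} → g C.∘ f C.≈ PC.0H → F₁ g ∘ F₁ f ≈ 0H
  F-killed gf≈0 = ≈-trans (F-triangle gf≈0) F-zero

  zero-reflecting⇒faithful : ∀ {A B} → (∀ (w : A C.⇒ B) → F₁ w ≈ 0H → w C.≈ PC.0H) →
                             (u v : A C.⇒ B) → F₁ u ≈ F₁ v → u C.≈ v
  zero-reflecting⇒faithful reflects u v Tu≈Tv = LC.HomGroup.x∙y⁻¹≈ε⇒x≈y u v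
    (reflects (u PC.+ (PC.- v)) (begin
      F₁ (u PC.+ (PC.- v))   ≈⟨ additive u (PC.- v) ⟩
      F₁ u + F₁ (PC.- v)     ≈⟨ +-cong Tu≈Tv F-neg ⟩
      F₁ v + (- F₁ v)        ≈⟨ +-AbGroup.inverseʳ (F₁ v) ⟩
      0H                     ∎))

  F-biproduct : ∀ {A B S} {p₁ : S C.⇒ A} {p₂ : S C.⇒ B} {i₁ : A C.⇒ S} {i₂ : B C.⇒ S} →
                Notions.WithPreadditive.IsBiproduct 𝒞 PC p₁ p₂ i₁ i₂ →
                IsBiproduct (F₁ p₁) (F₁ p₂) (F₁ i₁) (F₁ i₂)
  F-biproduct {p₁ = p₁} {p₂} {i₁} {i₂} (e₁₁ , e₂₂ , e₁₂ , e₂₁ , sum≈id) =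
      ≈-trans (F-triangle e₁₁) identity
    , ≈-trans (F-triangle e₂₂) identity
    , F-killed e₁₂
    , F-killed e₂₁
    , (begin
        (F₁ i₁ ∘ F₁ p₁) + (F₁ i₂ ∘ F₁ p₂)     ≈⟨ +-cong homomorphism homomorphism ⟨
        F₁ (i₁ C.∘ p₁) + F₁ (i₂ C.∘ p₂)       ≈⟨ additive _ _ ⟨
        F₁ ((i₁ C.∘ p₁) PC.+ (i₂ C.∘ p₂))     ≈⟨ F-resp-≈ sum≈id ⟩
        F₁ C.id                               ≈⟨ identity ⟩
        id                                    ∎)

  F-zero-object : ∀ {Z} → Notions.IsInitial 𝒞 Z → IsZeroObject (F₀ Z)
  F-zero-object init = id≈0⇒zero-object (begin
    id           ≈⟨ identity ⟨
    F₁ C.id      ≈⟨ F-resp-≈ (proj₁ (LC.initial⇒zero-object init) C.id) ⟩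
    F₁ PC.0H     ≈⟨ F-zero ⟩
    0H           ∎)

module ClassNotions {o ℓ e o′ ℓ′ e′ p} {𝒞 : Category o ℓ e} {𝒜 : Category o′ ℓ′ e′}
  (T : Functor 𝒞 𝒜) (P : Category.Obj 𝒞 → Set p) where
  private
    module C = Category 𝒞
  open Category 𝒜
  open Notions 𝒜 using (IsIso)
  open Functor T

  FaithfulOn : Set (o ⊔ ℓ ⊔ e ⊔ e′ ⊔ p)
  FaithfulOn = ∀ {X Y} → P X → P Y → (u v : X C.⇒ Y) → F₁ u ≈ F₁ v → u C.≈ v

  FullOn : Set (o ⊔ ℓ ⊔ ℓ′ ⊔ e′ ⊔ p)
  FullOn = ∀ {X Y} → P X → P Y → (φ : F₀ X ⇒ F₀ Y) → Σ (X C.⇒ Y) λ u → F₁ u ≈ φ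

  Representative : Set (o ⊔ ℓ′ ⊔ e′ ⊔ p)
  Representative = ∀ C → Σ C.Obj λ N → P N × Σ (F₀ N ⇒ F₀ C) IsIso

  record MinLike : Set (o ⊔ ℓ ⊔ e ⊔ o′ ⊔ ℓ′ ⊔ e′ ⊔ p) where
    field
      lift-iso       : ∀ {M Y} → P M → (f : F₀ M ⇒ F₀ Y) → IsIso f →
                       Σ (M C.⇒ Y) λ u → F₁ u ≈ f
      rigid          : ∀ {M} → P M → (u : M C.⇒ M) → F₁ u ≈ id → u C.≈ C.id
      representative : Representative

module _ {o ℓ e o′ ℓ′ e′ p} {𝒞 : Category o ℓ e} {𝒜 : Category o′ ℓ′ e′}
  {T : Functor 𝒞 𝒜} {P : Category.Obj 𝒞 → Set p} where
  private
    module N = ClassNotions T P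
    module Nᵒᵖ = ClassNotions (OpF T) P

  op-faithful : N.FaithfulOn → Nᵒᵖ.FaithfulOn
  op-faithful faithful PX PY = faithful PY PX

  op-full : N.FullOn → Nᵒᵖ.FullOn
  op-full full PX PY = full PY PX

  op-representative : N.Representative → Nᵒᵖ.Representative
  op-representative rep C =
    let (N , PN , n , n⁻¹ , n⁻¹∘n≈id , n∘n⁻¹≈id) = rep C
    in  N , PN , n⁻¹ , n , n⁻¹∘n≈id , n∘n⁻¹≈id

op-additive : ∀ {o ℓ e} {𝒞 : Category o ℓ e} → Notions.Additive 𝒞 → Notions.Additive (Op 𝒞)
op-additive add = record
  { preadditive = OpPA preadditive ; zero = zero ; zeroInit = zeroTerm ; zeroTerm = zeroInit
  ; biproduct = λ A B →
      let (S , p₁ , p₂ , i₁ , i₂ , e₁₁ , e₂₂ , e₁₂ , e₂₁ , sum≈id) = biproduct A B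
      in  S , i₁ , i₂ , p₁ , p₂ , e₁₁ , e₂₂ , e₂₁ , e₁₂ , sum≈id }
  where open Notions.Additive add

FullSubPA : ∀ {o ℓ e p} {𝒞 : Category o ℓ e} (P : Category.Obj 𝒞 → Set p) →
            Notions.Preadditive 𝒞 → Notions.Preadditive (FullSub 𝒞 P)
FullSubPA P PC = record { _+_ = _+_ ; 0H = 0H ; -_ = -_ ; isAbelianGroup = isAbelianGroup
                        ; ∘-distribˡ = ∘-distribˡ ; ∘-distribʳ = ∘-distribʳ }
  where open Notions.Preadditive PC

module PullbackKernels {o ℓ e o′ ℓ′ e′} {𝒞 : Category o ℓ e} {𝒜 : Category o′ ℓ′ e′}
  (T : Functor 𝒞 𝒜) (add𝒞 : Notions.Additive 𝒞) (PA : Notions.Preadditive 𝒜)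
  (additive : FunctorNotions.IsAdditiveFunctor T (Notions.Additive.preadditive add𝒞) PA)
  (pullbacks : Notions.HasPullbacks 𝒞) (T-pullbacks : FunctorNotions.PreservesPullbacks T)
  where
  private
    module C = Category 𝒞
    module CL = CategoryLemmas 𝒞
    module Add = Notions.Additive add𝒞
    PC : Notions.Preadditive 𝒞
    PC = Add.preadditive
    module PC = Notions.Preadditive PC
    module LC = PreadditiveLemmas 𝒞 PC
  open Category 𝒜
  open Notions 𝒜 using (IsMono)
  open Notions.WithPreadditive 𝒜 PA
  open Notions.Preadditive PA
  open CategoryLemmas 𝒜
  open PreadditiveLemmas 𝒜 PA
  open FunctorLemmas T
  open AdditiveFunctorLemmas T PC PA additive
  open Functor T

  image-kernel : ∀ {N A} (a : N C.⇒ A) →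
                 Σ C.Obj λ K → Σ (K C.⇒ N) λ k → a C.∘ k C.≈ PC.0H × IsKernel (F₁ a) (F₁ k)
  image-kernel {A = A} a with pullbacks a (proj₁ (Add.zeroInit A))
  ... | K , k , t , k-pullback =
      K , k
    , proj₁ (LC.pullback-along-zero (LC.initial⇒zero-object Add.zeroInit) k-pullback)
    , pullback-along-zero (F-zero-object Add.zeroInit) (T-pullbacks _ _ k t k-pullback)

  module FullyFaithful {p} (P : C.Obj → Set p) (minLike : ClassNotions.MinLike T P) where
    open ClassNotions T P
    open MinLike minLike

    lift-kernel : ∀ {M N A} → P M → (a : N C.⇒ A) (κ : F₀ M ⇒ F₀ N) → IsKernel (F₁ a) κ →
                  Σ (M C.⇒ N) λ q → F₁ q ≈ κ × a C.∘ q C.≈ PC.0H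
    lift-kernel PM a κ κ-kernel =
      let (_ , k , ak≈0 , Tk-kernel) = image-kernel a
          (u , Tk∘u≈κ , u-iso) = kernels-iso Tk-kernel κ-kernel
          (v , Tv≈u) = lift-iso PM u u-iso
      in  k C.∘ v
        , (begin
            F₁ (k C.∘ v)    ≈⟨ homomorphism ⟩
            F₁ k ∘ F₁ v     ≈⟨ refl⟩∘⟨ Tv≈u ⟩
            F₁ k ∘ u        ≈⟨ Tk∘u≈κ ⟩
            κ               ∎)
        , LC.killed-∘ ak≈0

    -- faithfulness: if T w ≈ 0, the identity of T M is a kernel of T w, so it lifts to
    -- an endomorphism q with w ∘ q ≈ 0, and q is the identity by rigidity
    faithful-from : ∀ {M Y} → P M → (u v : M C.⇒ Y) → F₁ u ≈ F₁ v → u C.≈ v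
    faithful-from PM = zero-reflecting⇒faithful reflects-zero
      where
        reflects-zero : ∀ w → F₁ w ≈ 0H → w C.≈ PC.0H
        reflects-zero w Tw≈0 =
          let (q , Tq≈id , wq≈0) = lift-kernel PM w id (id-kernel Tw≈0)
          in  CL.begin
                w             CL.≈⟨ C.identityʳ ⟨
                w C.∘ C.id    CL.≈⟨ CL.refl⟩∘⟨ rigid PM q Tq≈id ⟨
                w C.∘ q       CL.≈⟨ wq≈0 ⟩
                PC.0H         CL.∎

    -- fullness: let S = M ⊕ X, θ the graph automorphism of T S, and n : T N ≅ T S with
    -- N in P.  Lifting n and θ ∘ n gives uS, uθ : N → S, and n⁻¹ ∘ T i₁, a kernel of
    -- T (p₂ ∘ uS), lifts to q : M → N.  Then T (p₂ ∘ uθ ∘ q) ≈ T p₂ ∘ θ ∘ T i₁ ≈ φ.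
    full-from : ∀ {M X} → P M → (φ : F₀ M ⇒ F₀ X) → Σ (M C.⇒ X) λ u → F₁ u ≈ φ
    full-from {M} {X} PM φ with Add.biproduct M X
    ... | S , p₁ , p₂ , i₁ , i₂ , S-biproduct =
      let T-biproduct = F-biproduct S-biproduct
          (θ-iso , p₂θi₁≈φ) = graph-automorphism T-biproduct φ
          θ = id + F₁ i₂ ∘ (φ ∘ F₁ p₁)
          (N , PN , n , n-iso) = representative S
          (uS , TuS≈n) = lift-iso PN n n-iso
          (uθ , Tuθ≈θn) = lift-iso PN (θ ∘ n) (∘-iso n-iso θ-iso)
          κ-kernel : IsKernel (F₁ (p₂ C.∘ uS)) (inv n-iso ∘ F₁ i₁)
          κ-kernel = kernel-resp-≈ (≈-trans (refl⟩∘⟨ ≈-sym TuS≈n) (≈-sym homomorphism))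
                       (kernel-precompose-iso (biproduct-kernel T-biproduct) n-iso)
          (q , Tq≈κ , _) = lift-kernel PM (p₂ C.∘ uS) (inv n-iso ∘ F₁ i₁) κ-kernel
      in  p₂ C.∘ (uθ C.∘ q)
        , (begin
            F₁ (p₂ C.∘ (uθ C.∘ q))                  ≈⟨ homomorphism ⟩
            F₁ p₂ ∘ F₁ (uθ C.∘ q)                   ≈⟨ refl⟩∘⟨ homomorphism ⟩
            F₁ p₂ ∘ (F₁ uθ ∘ F₁ q)                  ≈⟨ refl⟩∘⟨ Tuθ≈θn ⟩∘⟨ Tq≈κ ⟩
            F₁ p₂ ∘ ((θ ∘ n) ∘ (inv n-iso ∘ F₁ i₁))  ≈⟨ refl⟩∘⟨ cancel-inverse (inv-iso n-iso) ⟩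
            F₁ p₂ ∘ (θ ∘ F₁ i₁)                     ≈⟨ p₂θi₁≈φ ⟩
            φ                                       ∎)

    faithful : FaithfulOn
    faithful PX _ = faithful-from PX

    full : FullOn
    full PX _ = full-from PX

  module SubcategoryKernels {p} (P : C.Obj → Set p)
    (faithful : ClassNotions.FaithfulOn T P) (full : ClassNotions.FullOn T P)
    (representative : ClassNotions.Representative T P) where
    𝒟 : Category (o ⊔ p) ℓ e
    𝒟 = FullSub 𝒞 P
    private
      module D = Notions.WithPreadditive 𝒟 (FullSubPA P PC)
      module LD = PreadditiveLemmas 𝒟 (FullSubPA P PC)

    reflect-zero : ∀ {X Y} → P X → P Y → (w : X C.⇒ Y) → F₁ w ≈ 0H → w C.≈ PC.0H
    reflect-zero PX PY w Tw≈0 = faithful PX PY w PC.0H (≈-trans Tw≈0 (≈-sym F-zero))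

    kernel-in : ∀ {X Y} → P X → (f : X C.⇒ Y) →
                Σ C.Obj λ N → P N × Σ (N C.⇒ X) λ k → IsKernel (F₁ f) (F₁ k)
    kernel-in PX f =
      let (K , k , _ , Tk-kernel) = image-kernel f
          (N , PN , n , n-iso) = representative K
          (k′ , Tk′≈Tk∘n) = full PN PX (F₁ k ∘ n)
      in  N , PN , k′ , kernel-∘-iso Tk-kernel n-iso (≈-sym Tk′≈Tk∘n)

    reflect-kernel : ∀ {K X Y : Category.Obj 𝒟}
                     (f : proj₁ X C.⇒ proj₁ Y) (k : proj₁ K C.⇒ proj₁ X) →
                     IsKernel (F₁ f) (F₁ k) → D.IsKernel {K} {X} {Y} f k
    reflect-kernel {K} {X} {Y} f k Tk-kernel =
        reflect-zero (proj₂ K) (proj₂ Y) (f C.∘ k) (≈-trans homomorphism (proj₁ Tk-kernel))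
      , λ {W} h fh≈0 →
        let (ū , Tk∘ū≈Th) = factor Tk-kernel (F₁ h) (F-killed fh≈0)
            (u , Tu≈ū) = full (proj₂ W) (proj₂ K) ū
            Tk∘Tu≈Th = ≈-trans (refl⟩∘⟨ Tu≈ū) Tk∘ū≈Th
        in  u
          , faithful (proj₂ W) (proj₂ X) _ _ (≈-trans homomorphism Tk∘Tu≈Th)
          , λ v kv≈h → faithful (proj₂ W) (proj₂ K) v u
              (kernel⇒mono Tk-kernel (F₁ v) (F₁ u)
                 (≈-trans (F-triangle kv≈h) (≈-sym Tk∘Tu≈Th)))

    -- T sends kernels in 𝒟 to kernels in 𝒜: compare with the kernel given by kernel-in
    preserve-kernel : ∀ {A B C : Category.Obj 𝒟}
                      {f : proj₁ A C.⇒ proj₁ B} {g : proj₁ B C.⇒ proj₁ C} →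
                      D.IsKernel {A} {B} {C} g f → IsKernel (F₁ g) (F₁ f)
    preserve-kernel {A} {B} {C} {g = g} f-kernel =
      let (N , PN , k , Tk-kernel) = kernel-in (proj₂ B) g
          k-kernel = reflect-kernel {N , PN} {B} {C} g k Tk-kernel
          (u , ku≈f , u-iso) = LD.kernels-iso {N , PN} {A} {B} {C} k-kernel f-kernel
      in  kernel-∘-iso Tk-kernel (F-iso u-iso) (F-triangle ku≈f)

    -- T preserves monomorphisms of 𝒟: the kernel of a monomorphism is zero
    preserve-mono : ∀ {X Y : Category.Obj 𝒟} (f : proj₁ X C.⇒ proj₁ Y) →
                    Notions.IsMono 𝒟 {X} {Y} f → IsMono (F₁ f)
    preserve-mono {X} {Y} f f-mono =
      let (N , PN , k , Tk-kernel) = kernel-in (proj₂ X) f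
          fk≈0 = reflect-zero PN (proj₂ Y) (f C.∘ k) (≈-trans homomorphism (proj₁ Tk-kernel))
          k≈0 = f-mono {N , PN} k PC.0H (CL.≈-trans fk≈0 (CL.≈-sym LC.∘-zeroʳ))
      in  zero-kernel⇒mono Tk-kernel (≈-trans (F-resp-≈ k≈0) F-zero)

-- Cokernels and normal
-- epimorphisms are kernels and normal monomorphisms for Tᵒᵖ.
module SubcategoryIsAbelian {o ℓ e o′ ℓ′ e′ p} {𝒞 : Category o ℓ e} {𝒜 : Category o′ ℓ′ e′}
  (T : Functor 𝒞 𝒜) (add𝒞 : Notions.Additive 𝒞) (ab𝒜 : Notions.Abelian 𝒜)
  (additive : FunctorNotions.IsAdditiveFunctor T
     (Notions.Additive.preadditive add𝒞) (Notions.Abelian.preadditive ab𝒜))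
  (pullbacks : Notions.HasPullbacks 𝒞) (T-pullbacks : FunctorNotions.PreservesPullbacks T)
  (pushouts : Notions.HasPushouts 𝒞) (T-pushouts : FunctorNotions.PreservesPushouts T)
  (P : Category.Obj 𝒞 → Set p)
  (faithful : ClassNotions.FaithfulOn T P) (full : ClassNotions.FullOn T P)
  (representative : ClassNotions.Representative T P) where
  private
    module C = Category 𝒞
    module Add = Notions.Additive add𝒞
    PC : Notions.Preadditive 𝒞
    PC = Add.preadditive
    module PC = Notions.Preadditive PC
    module Ab = Notions.Abelian ab𝒜
    PA : Notions.Preadditive 𝒜
    PA = Ab.preadditive
    module PK = PullbackKernels T add𝒞 PA additive pullbacks T-pullbacks
    module Ker = PK.SubcategoryKernels P faithful full representative
    module PKᵒᵖ = PullbackKernels (OpF T) (op-additive add𝒞) (OpPA PA) additive pushouts T-pushouts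
    module Cok = PKᵒᵖ.SubcategoryKernels P (op-faithful {T = T} faithful) (op-full {T = T} full)
                   (op-representative {T = T} representative)
    module Lᵒᵖ = PreadditiveLemmas (Op 𝒜) (OpPA PA)
  open Category 𝒜
  open Notions.Preadditive PA using (_+_)
  open Notions.WithPreadditive 𝒜 PA
  open CategoryLemmas 𝒜
  open PreadditiveLemmas 𝒜 PA
  open AdditiveFunctorLemmas T PC PA additive
  open Functor T

  𝒟 : Category (o ⊔ p) ℓ e
  𝒟 = FullSub 𝒞 P
  private
    module D = Category 𝒟
    module DN = Notions.WithPreadditive 𝒟 (FullSubPA P PC)

  reflect-∘ : ∀ {X Y W} {a : Y C.⇒ W} {b : X C.⇒ Y} {c : X C.⇒ W} {x y} → P X → P W →
              F₁ a ≈ x → F₁ b ≈ y → x ∘ y ≈ F₁ c → a C.∘ b C.≈ c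
  reflect-∘ PX PW Ta≈x Tb≈y xy≈Tc = faithful PX PW _ _
    (≈-trans homomorphism (≈-trans (Ta≈x ⟩∘⟨ Tb≈y) xy≈Tc))

  reflect-zero-object : ∀ (N₀ : D.Obj) → IsZeroObject (F₀ (proj₁ N₀)) →
                        Notions.IsInitial 𝒟 N₀ × Notions.IsTerminal 𝒟 N₀
  reflect-zero-object (N₀ , PN₀) (into , out-of) =
      (λ X → PC.0H , lift tt ,
             λ v _ → faithful PN₀ (proj₂ X) v PC.0H (≈-trans (out-of _) (≈-sym (out-of _))))
    , (λ X → PC.0H , lift tt ,
             λ v _ → faithful (proj₂ X) PN₀ v PC.0H (≈-trans (into _) (≈-sym (into _))))

  zero-object : Σ D.Obj λ N₀ → Notions.IsInitial 𝒟 N₀ × Notions.IsTerminal 𝒟 N₀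
  zero-object =
    let (N₀ , PN₀ , _ , n₀-iso) = representative Add.zero
    in  (N₀ , PN₀) , reflect-zero-object (N₀ , PN₀)
                       (iso-zero-object n₀-iso (F-zero-object Add.zeroInit))

  reflect-biproduct : ∀ {A B S : D.Obj}
    {P₁ : proj₁ S C.⇒ proj₁ A} {P₂ : proj₁ S C.⇒ proj₁ B}
    {I₁ : proj₁ A C.⇒ proj₁ S} {I₂ : proj₁ B C.⇒ proj₁ S} {q₁ q₂ j₁ j₂} →
    IsBiproduct q₁ q₂ j₁ j₂ → F₁ P₁ ≈ q₁ → F₁ P₂ ≈ q₂ → F₁ I₁ ≈ j₁ → F₁ I₂ ≈ j₂ →
    DN.IsBiproduct {A} {B} {S} P₁ P₂ I₁ I₂
  reflect-biproduct {A , PA′} {B , PB} {S , PS} {P₁} {P₂} {I₁} {I₂} {q₁} {q₂} {j₁} {j₂}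
                    (e₁₁ , e₂₂ , e₁₂ , e₂₁ , sum≈id) TP₁ TP₂ TI₁ TI₂ =
      reflect-∘ PA′ PA′ TP₁ TI₁ (≈-trans e₁₁ (≈-sym identity))
    , reflect-∘ PB PB TP₂ TI₂ (≈-trans e₂₂ (≈-sym identity))
    , reflect-∘ PB PA′ TP₁ TI₂ (≈-trans e₁₂ (≈-sym F-zero))
    , reflect-∘ PA′ PB TP₂ TI₁ (≈-trans e₂₁ (≈-sym F-zero))
    , faithful PS PS _ _ (begin
        F₁ ((I₁ C.∘ P₁) PC.+ (I₂ C.∘ P₂))     ≈⟨ additive _ _ ⟩
        F₁ (I₁ C.∘ P₁) + F₁ (I₂ C.∘ P₂)       ≈⟨ +-cong homomorphism homomorphism ⟩
        (F₁ I₁ ∘ F₁ P₁) + (F₁ I₂ ∘ F₁ P₂)     ≈⟨ +-cong (TI₁ ⟩∘⟨ TP₁) (TI₂ ⟩∘⟨ TP₂) ⟩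
        (j₁ ∘ q₁) + (j₂ ∘ q₂)                 ≈⟨ sum≈id ⟩
        id                                    ≈⟨ identity ⟨
        F₁ C.id                               ∎)

  -- the biproduct in 𝒟: a representative of the biproduct in 𝒞, with the structure
  -- morphisms transported along the comparison isomorphism and lifted by fullness
  biproductᴰ : ∀ (X Y : D.Obj) → Σ D.Obj λ S →
    Σ (S D.⇒ X) λ P₁ → Σ (S D.⇒ Y) λ P₂ → Σ (X D.⇒ S) λ I₁ → Σ (Y D.⇒ S) λ I₂ →
    DN.IsBiproduct {X} {Y} {S} P₁ P₂ I₁ I₂
  biproductᴰ (X , PX) (Y , PY) =
    let (S , p₁ , p₂ , i₁ , i₂ , S-biproduct) = Add.biproduct X Y
        (N , PN , n , n-iso) = representative S
        (P₁ , TP₁) = full PN PX (F₁ p₁ ∘ n)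
        (P₂ , TP₂) = full PN PY (F₁ p₂ ∘ n)
        (I₁ , TI₁) = full PX PN (inv n-iso ∘ F₁ i₁)
        (I₂ , TI₂) = full PY PN (inv n-iso ∘ F₁ i₂)
    in  (N , PN) , P₁ , P₂ , I₁ , I₂
      , reflect-biproduct {X , PX} {Y , PY} {N , PN}
          (transport-biproduct n-iso (F-biproduct S-biproduct)) TP₁ TP₂ TI₁ TI₂

  abelian : Notions.Abelian 𝒟
  abelian = record
    { additive = record
        { preadditive = FullSubPA P PC
        ; zero = proj₁ zero-object
        ; zeroInit = proj₁ (proj₂ zero-object)
        ; zeroTerm = proj₂ (proj₂ zero-object)
        ; biproduct = biproductᴰ }
    ; kernel = λ {B} {C} g →
        let (N , PN , k , Tk-kernel) = Ker.kernel-in (proj₂ B) g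
        in  (N , PN) , k , Ker.reflect-kernel {N , PN} {B} {C} g k Tk-kernel
    ; cokernel = λ {A} {B} f →
        let (N , PN , c , Tc-cokernel) = Cok.kernel-in (proj₂ B) f
        in  (N , PN) , c , Cok.reflect-kernel {N , PN} {B} {A} f c Tc-cokernel
    -- a monomorphism of 𝒟 is a kernel of its cokernel, because its image is a
    -- monomorphism of 𝒜, hence normal
    ; monoNormal = λ {A} {B} f f-mono →
        let (Q , PQ , c , Tc-cokernel) = Cok.kernel-in (proj₂ B) f
            (_ , _ , Tf-normal) = Ab.monoNormal (F₁ f) (Ker.preserve-mono {A} {B} f (λ {X} → f-mono {X}))
        in  (Q , PQ) , c , Ker.reflect-kernel {A} {B} {Q , PQ} c f
                             (kernel-of-cokernel Tf-normal Tc-cokernel)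
    ; epiNormal = λ {A} {B} g g-epi →
        let (K , PK , k , Tk-kernel) = Ker.kernel-in (proj₂ A) g
            (_ , _ , Tg-normal) = Ab.epiNormal (F₁ g) (Cok.preserve-mono {B} {A} g (λ {X} → g-epi {X}))
        in  (K , PK) , k , Cok.reflect-kernel {B} {A} {K , PK} k g
                             (Lᵒᵖ.kernel-of-cokernel Tg-normal Tk-kernel)
    }

  exact : FunctorNotions.IsExact (restrict P T) abelian ab𝒜
  exact {A} {B} {C} f g f-kernel g-cokernel =
    Ker.preserve-kernel {A} {B} {C} f-kernel , Cok.preserve-kernel {C} {B} {A} g-cokernel

module FibreLemmas {o ℓ e o′ ℓ′ e′} {𝒞 : Category o ℓ e} {𝒜 : Category o′ ℓ′ e′}
  (T : Functor 𝒞 𝒜) where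
  private
    module C = Category 𝒞
    module CL = CategoryLemmas 𝒞
  open Category 𝒜
  open CategoryLemmas 𝒜
  open Functor T
  open FibreNotions T
  open ClassNotions

  -- the fibre over T N is the fibre over A composed with n : T N ≅ A, so an initial
  -- object (N , n) of 𝓕_A makes N an object of Min(𝒞)
  initial⇒min : ∀ {A} {X : FibObj A} → IsInitialFib X → IsMin (proj₁ X)
  initial⇒min {X = _ , n , n-iso} initial (Y , f , f-iso) =
    let ((u , n≈nf∘Tu) , unique) = initial (Y , n ∘ f , ∘-iso f-iso n-iso)
    in  (u , iso-cancelˡ n-iso (≈-trans identityʳ (≈-trans n≈nf∘Tu assoc)))
      , λ (g , id≈f∘Tg) →
          unique (g , ≈-trans (≈-sym identityʳ) (≈-trans (refl⟩∘⟨ id≈f∘Tg) assoc˘))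

  final⇒max : ∀ {A} {X : FibObj A} → IsFinalFib X → IsMax (proj₁ X)
  final⇒max {X = _ , n , n-iso} final (Y , f , f-iso) =
    let ((u , nf≈n∘Tu) , unique) = final (Y , n ∘ f , ∘-iso f-iso n-iso)
    in  (u , ≈-trans (iso-cancelˡ n-iso nf≈n∘Tu) (≈-sym identityˡ))
      , λ (g , f≈id∘Tg) → unique (g , refl⟩∘⟨ ≈-trans f≈id∘Tg identityˡ)

  -- an endomorphism of M over the identity of T M is an endomorphism of (M , id) in
  -- 𝓕_{T M}, so it is the identity when such endomorphisms are unique
  endomorphism-unique : ∀ {M} {w : M C.⇒ M} →
    (∀ (v : FibHom (canon M) (canon M)) → proj₁ v C.≈ w) →
    (u : M C.⇒ M) → F₁ u ≈ id → u C.≈ C.id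
  endomorphism-unique unique u Tu≈id = CL.≈-trans
    (unique (u , ≈-sym (≈-trans identityˡ Tu≈id)))
    (CL.≈-sym (unique (C.id , ≈-sym (≈-trans identityˡ identity))))

  min-like : Ax3* → MinLike T IsMin
  min-like ax3* = record
    { lift-iso = λ {Y = Y} PM f f-iso →
        let ((u , id≈f⁻¹∘Tu) , _) = PM (Y , inv f-iso , inv-iso f-iso)
        in  u , iso-cancelˡ (inv-iso f-iso) (≈-trans (≈-sym id≈f⁻¹∘Tu) (≈-sym (invˡ f-iso)))
    ; rigid = λ {M} PM → endomorphism-unique (proj₂ (PM (canon M)))
    ; representative = λ C →
        let ((N , n , n-iso) , initial) = ax3* (F₀ C) (canon C)
        in  N , initial⇒min {X = N , n , n-iso} initial , n , n-iso
    }

  max-representative : Ax3 → Representative T IsMax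
  max-representative ax3 C =
    let ((N , n , n-iso) , final) = ax3 (F₀ C) (canon C)
    in  N , final⇒max {X = N , n , n-iso} final , n , n-iso

  max-like : Ax3 → MinLike (OpF T) IsMax
  max-like ax3 = record
    { lift-iso = λ {Y = Y} PM f f-iso →
        let ((u , f≈id∘Tu) , _) = PM (Y , f , op-iso {𝒜 = Op 𝒜} f-iso)
        in  u , ≈-sym (≈-trans f≈id∘Tu identityˡ)
    ; rigid = λ {M} PM → endomorphism-unique (proj₂ (PM (canon M)))
    ; representative = op-representative {T = T} (max-representative ax3)
    }

proposition1p5p2 : ∀ {o ℓ e o′ ℓ′ e′ : Level}
    (𝒞 : Category o ℓ e) (𝒜 : Category o′ ℓ′ e′) (T : Functor 𝒞 𝒜) →
    FibreNotions.Ax0 T →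
    Notions.HasPushouts 𝒞 → Notions.HasPushouts 𝒜 →
    FunctorNotions.PreservesPushouts T →
    FibreNotions.Ax3 T →
    Notions.HasPullbacks 𝒞 → Notions.HasPullbacks 𝒜 →
    FunctorNotions.PreservesPullbacks T →
    FibreNotions.Ax3* T →
    (add𝒞 : Notions.Additive 𝒞) (ab𝒜 : Notions.Abelian 𝒜) →
    FunctorNotions.IsAdditiveFunctor T
      (Notions.Additive.preadditive add𝒞) (Notions.Abelian.preadditive ab𝒜) →
    (Σ (Notions.Abelian (FibreNotions.Max T)) λ abMax →
       FunctorNotions.IsExact (restrict (FibreNotions.IsMax T) T) abMax ab𝒜)
    ×
    (Σ (Notions.Abelian (FibreNotions.Min T)) λ abMin →
       FunctorNotions.IsExact (restrict (FibreNotions.IsMin T) T) abMin ab𝒜)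
proposition1p5p2 𝒞 𝒜 T _ pushouts _ T-pushouts ax3 pullbacks _ T-pullbacks ax3*
                 add𝒞 ab𝒜 additive =
    (Max.abelian , λ {A} {B} {C} → Max.exact {A} {B} {C})
  , (Min.abelian , λ {A} {B} {C} → Min.exact {A} {B} {C})
  where
    open FibreNotions T using (IsMax; IsMin)
    open FibreLemmas T
    PA : Notions.Preadditive 𝒜
    PA = Notions.Abelian.preadditive ab𝒜
    -- T is fully faithful on Min(𝒞) (Min-like for T), and Tᵒᵖ on Max(𝒞) (Min-like for
    -- Tᵒᵖ); full faithfulness of Tᵒᵖ is full faithfulness of T
    module FFMin = PullbackKernels.FullyFaithful T add𝒞 PA additive pullbacks T-pullbacks
                     IsMin (min-like ax3*)
    module FFMax = PullbackKernels.FullyFaithful (OpF T) (op-additive add𝒞) (OpPA PA)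
                     additive pushouts T-pushouts IsMax (max-like ax3)
    -- both classes represent every object, so both subcategories are abelian
    module Min = SubcategoryIsAbelian T add𝒞 ab𝒜 additive pullbacks T-pullbacks
                   pushouts T-pushouts IsMin FFMin.faithful FFMin.full
                   (ClassNotions.MinLike.representative (min-like ax3*))
    module Max = SubcategoryIsAbelian T add𝒞 ab𝒜 additive pullbacks T-pullbacks
                   pushouts T-pushouts IsMax
                   (op-faithful {T = OpF T} FFMax.faithful) (op-full {T = OpF T} FFMax.full)
                   (max-representative ax3)
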